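{- For all PCoR* terms $t, s$ over $\Sigma$: $\mathsf{REL} \models t \le s$ if and only if $\mathcal{C}_t \models t \le s$, where $\mathcal{C}_t$ is the class of structures $S$ for which there exist $x, y \in |S|$ such that $\mathrm{G}(S,x,y)$ is isomorphic to a graph in $\mathcal{G}(t)$.
   Context: PCoR* terms over $\Sigma$: $t ::= a \mid 1 \mid 0 \mid \top \mid t;t \mid t+t \mid t\cap t \mid t^{\smile} \mid t^{*}$, $a\in\Sigma$. A structure $S$ is a non-empty set $|S|$ with $a^S\subseteq|S|^2$ for each $a\in\Sigma$; semantics $[\![a]\!]_S=a^S$, $[\![1]\!]_S$ = identity on $|S|$, $[\![0]\!]_S=\emptyset$, $[\![\top]\!]_S=|S|^2$, and $;,+,\cap,{}^{\smile},{}^{*}$ are composition, union, intersection, converse, reflexive-transitive closure. $\mathsf{REL}$ = class of all structures; $\mathcal C\models t\le s$ means $[\![t]\!]_S\subseteq[\![s]\!]_S$ for all $S\in\mathcal C$. A graph over $\Sigma$ is $G=(|G|,(a^G)_{a\in\Sigma},\mathrm{src}^G,\mathrm{tgt}^G)$ with $a^G\subseteq|G|^2$, $\mathrm{src}^G,\mathrm{tgt}^G\in|G|$; isomorphisms are bijections preserving and reflecting all $a$-relations and preserving source and target. For a structure $S$ and $x,y\in|S|$, $\mathrm{G}(S,x,y)=(|S|,(a^S)_{a},x,y)$. Series composition $G;H$: disjoint union with $\mathrm{tgt}^G$ and $\mathrm{src}^H$ identified. Parallel composition $G\parallel H$: disjoint union with sources identified and targets identified. Graph language (up to isomorphism): $\mathcal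 G(a)$ = single edge $u\xrightarrow{a}v$, $u\ne v$, source $u$, target $v$; $\mathcal G(1)$ = one vertex, source = target, no edges; $\mathcal G(0)=\emptyset$; $\mathcal G(\top)$ = two distinct isolated vertices as source and target; $\mathcal G(t^{\smile})$ = members of $\mathcal G(t)$ with source and target swapped; $\mathcal G(t\cap s)=\{G\parallel H\}$, $\mathcal G(t;s)=\{G;H\}$ for $G\in\mathcal G(t)$, $H\in\mathcal G(s)$; $\mathcal G(t+s)=\mathcal G(t)\cup\mathcal G(s)$; $\mathcal G(t^{*})=\bigcup_{n\ge0}\mathcal G(t^n)$ with $t^0=1$, $t^n=t;t^{n-1}$. -}

module Defs where

open import Data.Nat using (ℕ; zero; suc)
open import Data.Bool using (Bool; false; true)
open import Data.Unit using (⊤; tt)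
open import Data.Empty using (⊥)
open import Data.Sum using (_⊎_; inj₁; inj₂)
open import Data.Product using (Σ; Σ-syntax; ∃; ∃-syntax; _×_; _,_)
open import Level using (Lift)
open import Function.Bundles using (_⇔_)
open import Relation.Binary using (IsEquivalence)
open import Relation.Binary.PropositionalEquality using (_≡_; isEquivalence)
open import Relation.Binary.Construct.Closure.ReflexiveTransitive using (Star)
open import Relation.Binary.Construct.Closure.Equivalence
  using (EqClosure) renaming (isEquivalence to eqClosure-isEquivalence)

infixl 6 _⊕_
infixl 7 _⊓_
infixl 8 _⨾_
infix 9 _˘ _⋆

data Term (Alph : Set) : Set where
  atom : Alph → Term Alph
  one  : Term Alph
  zer  : Term Alph
  top  : Term Alph
  _⨾_  : Term Alph → Term Alph → Term Alph
  _⊕_  : Term Alph → Term Alph → Term Alph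
  _⊓_  : Term Alph → Term Alph → Term Alph
  _˘   : Term Alph → Term Alph
  _⋆   : Term Alph → Term Alph

pow : {Alph : Set} → ℕ → Term Alph → Term Alph
pow zero    t = one
pow (suc n) t = t ⨾ pow n t

record Structure (Alph : Set) : Set₁ where
  field
    Carrier  : Set
    nonempty : Carrier
    rel      : Alph → Carrier → Carrier → Set
open Structure public

⟦_⟧ : {Alph : Set} → Term Alph → (S : Structure Alph) → Carrier S → Carrier S → Set
⟦ atom a ⟧ S x y = rel S a x y
⟦ one    ⟧ S x y = x ≡ y
⟦ zer    ⟧ S x y = ⊥
⟦ top    ⟧ S x y = ⊤
⟦ t ⨾ s  ⟧ S x y = ∃[ z ] (⟦ t ⟧ S x z × ⟦ s ⟧ S z y)
⟦ t ⊕ s  ⟧ S x y = ⟦ t ⟧ S x y ⊎ ⟦ s ⟧ S x y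
⟦ t ⊓ s  ⟧ S x y = ⟦ t ⟧ S x y × ⟦ s ⟧ S x y
⟦ t ˘    ⟧ S x y = ⟦ t ⟧ S y x
⟦ t ⋆    ⟧ S x y = Star (⟦ t ⟧ S) x y

Class : Set → Set₂
Class Alph = Structure Alph → Set₁

_⊨_≤_ : {Alph : Set} → Class Alph → Term Alph → Term Alph → Set₁
𝒞 ⊨ t ≤ s = ∀ S → 𝒞 S → ∀ x y → ⟦ t ⟧ S x y → ⟦ s ⟧ S x y

REL : {Alph : Set} → Class Alph
REL S = Lift _ ⊤

-- Since Agda has no quotient types, the vertex set of a graph
-- is a setoid: a type V with an equivalence _≈_; the actual vertices are
-- the ≈-classes, and there is an a-edge between classes [u],[w] iff
-- some representatives are related by E a (see EdgeCl).

record Graph (Alph : Set) : Set₁ where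
  field
    V     : Set
    _≈_   : V → V → Set
    isEq  : IsEquivalence _≈_
    E     : Alph → V → V → Set
    src   : V
    tgt   : V
open Graph public

EdgeCl : {Alph : Set} (G : Graph Alph) → Alph → V G → V G → Set
EdgeCl G a u w = ∃[ u′ ] ∃[ w′ ] (_≈_ G u u′ × _≈_ G w w′ × E G a u′ w′)

record Iso {Alph : Set} (G H : Graph Alph) : Set where
  field
    to        : V G → V H
    from      : V H → V G
    to-cong   : ∀ {u w} → _≈_ G u w → _≈_ H (to u) (to w)
    from-cong : ∀ {u w} → _≈_ H u w → _≈_ G (from u) (from w)
    from-to   : ∀ u → _≈_ G (from (to u)) u
    to-from   : ∀ v → _≈_ H (to (from v)) v
    preserve  : ∀ a u w → EdgeCl G a u w → EdgeCl H a (to u) (to w)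
    reflect   : ∀ a u w → EdgeCl H a (to u) (to w) → EdgeCl G a u w
    pres-src  : _≈_ H (to (src G)) (src H)
    pres-tgt  : _≈_ H (to (tgt G)) (tgt H)

graphOf : {Alph : Set} (S : Structure Alph) → Carrier S → Carrier S → Graph Alph
graphOf S x y = record
  { V = Carrier S ; _≈_ = _≡_ ; isEq = isEquivalence
  ; E = rel S ; src = x ; tgt = y }

edgeGraph : {Alph : Set} → Alph → Graph Alph
edgeGraph a = record
  { V = Bool ; _≈_ = _≡_ ; isEq = isEquivalence
  ; E = λ b u w → b ≡ a × u ≡ false × w ≡ true
  ; src = false ; tgt = true }

oneGraph : {Alph : Set} → Graph Alph
oneGraph = record
  { V = ⊤ ; _≈_ = _≡_ ; isEq = isEquivalence
  ; E = λ _ _ _ → ⊥ ; src = tt ; tgt = tt }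

topGraph : {Alph : Set} → Graph Alph
topGraph = record
  { V = Bool ; _≈_ = _≡_ ; isEq = isEquivalence
  ; E = λ _ _ _ → ⊥ ; src = false ; tgt = true }

swapGraph : {Alph : Set} → Graph Alph → Graph Alph
swapGraph G = record
  { V = V G ; _≈_ = _≈_ G ; isEq = isEq G
  ; E = E G ; src = tgt G ; tgt = src G }

data SumE {Alph : Set} (G H : Graph Alph) (a : Alph) : V G ⊎ V H → V G ⊎ V H → Set where
  inl : ∀ {u w} → E G a u w → SumE G H a (inj₁ u) (inj₁ w)
  inr : ∀ {u w} → E H a u w → SumE G H a (inj₂ u) (inj₂ w)

data SerR {Alph : Set} (G H : Graph Alph) : V G ⊎ V H → V G ⊎ V H → Set where
  inl  : ∀ {u w} → _≈_ G u w → SerR G H (inj₁ u) (inj₁ w)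
  inr  : ∀ {u w} → _≈_ H u w → SerR G H (inj₂ u) (inj₂ w)
  glue : SerR G H (inj₁ (tgt G)) (inj₂ (src H))

data ParR {Alph : Set} (G H : Graph Alph) : V G ⊎ V H → V G ⊎ V H → Set where
  inl    : ∀ {u w} → _≈_ G u w → ParR G H (inj₁ u) (inj₁ w)
  inr    : ∀ {u w} → _≈_ H u w → ParR G H (inj₂ u) (inj₂ w)
  glue-s : ParR G H (inj₁ (src G)) (inj₂ (src H))
  glue-t : ParR G H (inj₁ (tgt G)) (inj₂ (tgt H))

_⊙_ : {Alph : Set} → Graph Alph → Graph Alph → Graph Alph
G ⊙ H = record
  { V = V G ⊎ V H ; _≈_ = EqClosure (SerR G H)
  ; isEq = eqClosure-isEquivalence (SerR G H)
  ; E = SumE G H ; src = inj₁ (src G) ; tgt = inj₂ (tgt H) }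

_∥_ : {Alph : Set} → Graph Alph → Graph Alph → Graph Alph
G ∥ H = record
  { V = V G ⊎ V H ; _≈_ = EqClosure (ParR G H)
  ; isEq = eqClosure-isEquivalence (ParR G H)
  ; E = SumE G H ; src = inj₁ (src G) ; tgt = inj₁ (tgt G) }

data Lang {Alph : Set} : Term Alph → Graph Alph → Set₁ where
  l-atom : ∀ a → Lang (atom a) (edgeGraph a)
  l-one  : Lang one oneGraph
  l-top  : Lang top topGraph
  l-conv : ∀ {t G} → Lang t G → Lang (t ˘) (swapGraph G)
  l-cap  : ∀ {t s G H} → Lang t G → Lang s H → Lang (t ⊓ s) (G ∥ H)
  l-seq  : ∀ {t s G H} → Lang t G → Lang s H → Lang (t ⨾ s) (G ⊙ H)
  l-plusˡ : ∀ {t s G} → Lang t G → Lang (t ⊕ s) G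
  l-plusʳ : ∀ {t s G} → Lang s G → Lang (t ⊕ s) G
  l-star : ∀ {t G} n → Lang (pow n t) G → Lang (t ⋆) G
  -- no constructor for zer: 𝒢(0) = ∅

𝒞 : {Alph : Set} → Term Alph → Class Alph
𝒞 t S = ∃[ x ] ∃[ y ] ∃[ H ] (Lang t H × Iso (graphOf S x y) H)

{-# OPTIONS --safe #-}
module Submission where

open import Defs
open import Function.Bundles using (_⇔_; mk⇔)
open import Data.Nat using (ℕ; zero; suc)
open import Data.Bool using (Bool; false; true)
open import Data.Bool.Properties using () renaming (_≟_ to _≟𝔹_)
open import Data.Unit using (tt)
open import Data.Unit.Properties using () renaming (_≟_ to _≟⊤_)
open import Data.Empty using (⊥-elim)
open import Data.Sum using (_⊎_; inj₁; inj₂; [_,_]′)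
open import Data.Sum.Properties using (≡-dec)
open import Data.Sum.Relation.Binary.Pointwise using (Pointwise; inj₁; inj₂)
open import Data.Product using (Σ; ∃-syntax; _,_; proj₁)
open import Level using (0ℓ; lift)
open import Relation.Nullary using (yes; no; ¬_)
open import Relation.Binary using (Rel; _⇒_; DecidableEquality; IsEquivalence)
open import Relation.Binary.PropositionalEquality
  using (_≡_; refl; sym; trans; cong; subst; subst₂; isEquivalence)
open import Relation.Binary.Construct.Closure.ReflexiveTransitive using (ε; _◅_)
import Relation.Binary.Construct.Closure.ReflexiveTransitive as Star
open import Relation.Binary.Construct.Closure.Equivalence
  using (EqClosure; return; fold; gfold)
  renaming (isEquivalence to EqClosure-isEquivalence; setoid to EqClosure-setoid)
import Relation.Binary.Reasoning.Setoid as ≈-Reasoning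
open import Axiom.UniquenessOfIdentityProofs using (module Decidable⇒UIP)

-- If t relates x and y in a structure S, some G ∈ 𝒢(t) maps homomorphically into
-- S with source and target sent to x and y. Read as a structure, the quotient of
-- G by its vertex identification lies in 𝒞_t and relates the classes of source
-- and target by t (every graph of 𝒢(t) satisfies t along any homomorphism), hence
-- by s. PCoR* has no complement, so s is preserved along the homomorphism from
-- the quotient into S induced by the one from G.

module _ {Alph : Set} where

  ⟦pow⟧⇒⟦⋆⟧ : {t : Term Alph} (S : Structure Alph) (n : ℕ) {x y : Carrier S} →
              ⟦ pow n t ⟧ S x y → ⟦ t ⋆ ⟧ S x y
  ⟦pow⟧⇒⟦⋆⟧ S zero    refl        = ε
  ⟦pow⟧⇒⟦⋆⟧ S (suc n) (_ , p , q) = p ◅ ⟦pow⟧⇒⟦⋆⟧ S n q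

  ⟦⟧-preserved : (t : Term Alph) {S T : Structure Alph} (f : Carrier S → Carrier T) →
                 (∀ a {i j} → rel S a i j → rel T a (f i) (f j)) →
                 {x y : Carrier S} → ⟦ t ⟧ S x y → ⟦ t ⟧ T (f x) (f y)
  ⟦⟧-preserved (atom a) f f-rel p             = f-rel a p
  ⟦⟧-preserved one      f f-rel p             = cong f p
  ⟦⟧-preserved zer      f f-rel ()
  ⟦⟧-preserved top      f f-rel p             = tt
  ⟦⟧-preserved (t ⨾ s)  f f-rel (z , p , q)   =
    f z , ⟦⟧-preserved t f f-rel p , ⟦⟧-preserved s f f-rel q
  ⟦⟧-preserved (t ⊕ s)  f f-rel (inj₁ p)      = inj₁ (⟦⟧-preserved t f f-rel p)
  ⟦⟧-preserved (t ⊕ s)  f f-rel (inj₂ q)      = inj₂ (⟦⟧-preserved s f f-rel q)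
  ⟦⟧-preserved (t ⊓ s)  f f-rel (p , q)       =
    ⟦⟧-preserved t f f-rel p , ⟦⟧-preserved s f f-rel q
  ⟦⟧-preserved (t ˘)    f f-rel p             = ⟦⟧-preserved t f f-rel p
  ⟦⟧-preserved (t ⋆)    f f-rel p             = Star.gmap f (⟦⟧-preserved t f f-rel) p

  record Hom (G : Graph Alph) (S : Structure Alph) : Set where
    field
      h      : V G → Carrier S
      h-cong : ∀ {u w} → _≈_ G u w → h u ≡ h w
      h-edge : ∀ a {u w} → E G a u w → rel S a (h u) (h w)
  open Hom

  -- Graph has η, so swapGraph (swapGraph G) is G and this also converts backwards.
  swap-Hom : {G : Graph Alph} {S : Structure Alph} → Hom G S → Hom (swapGraph G) S
  swap-Hom φ = record { h = h φ ; h-cong = h-cong φ ; h-edge = h-edge φ }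

  module _ {G H : Graph Alph} {S : Structure Alph} where

    ⊙-Homˡ : Hom (G ⊙ H) S → Hom G S
    ⊙-Homˡ φ = record
      { h = λ u → h φ (inj₁ u)
      ; h-cong = λ u≈w → h-cong φ (return (inl u≈w))
      ; h-edge = λ a e → h-edge φ a (inl e) }

    ⊙-Homʳ : Hom (G ⊙ H) S → Hom H S
    ⊙-Homʳ φ = record
      { h = λ u → h φ (inj₂ u)
      ; h-cong = λ u≈w → h-cong φ (return (inr u≈w))
      ; h-edge = λ a e → h-edge φ a (inr e) }

    ∥-Homˡ : Hom (G ∥ H) S → Hom G S
    ∥-Homˡ φ = record
      { h = λ u → h φ (inj₁ u)
      ; h-cong = λ u≈w → h-cong φ (return (inl u≈w))
      ; h-edge = λ a e → h-edge φ a (inl e) }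

    ∥-Homʳ : Hom (G ∥ H) S → Hom H S
    ∥-Homʳ φ = record
      { h = λ u → h φ (inj₂ u)
      ; h-cong = λ u≈w → h-cong φ (return (inr u≈w))
      ; h-edge = λ a e → h-edge φ a (inr e) }

    module _ (φ : Hom G S) (ψ : Hom H S) where

      copair-edge : ∀ a {u w} → SumE G H a u w →
                    rel S a ([ h φ , h ψ ]′ u) ([ h φ , h ψ ]′ w)
      copair-edge a (inl e) = h-edge φ a e
      copair-edge a (inr e) = h-edge ψ a e

      ⊙-Hom : h φ (tgt G) ≡ h ψ (src H) → Hom (G ⊙ H) S
      ⊙-Hom tgt≡src = record
        { h = [ h φ , h ψ ]′
        ; h-cong = gfold isEquivalence [ h φ , h ψ ]′ respects
        ; h-edge = copair-edge }
        where
        respects : ∀ {u w} → SerR G H u w → [ h φ , h ψ ]′ u ≡ [ h φ , h ψ ]′ w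
        respects (inl u≈w) = h-cong φ u≈w
        respects (inr u≈w) = h-cong ψ u≈w
        respects glue      = tgt≡src

      ∥-Hom : h φ (src G) ≡ h ψ (src H) → h φ (tgt G) ≡ h ψ (tgt H) → Hom (G ∥ H) S
      ∥-Hom src≡src tgt≡tgt = record
        { h = [ h φ , h ψ ]′
        ; h-cong = gfold isEquivalence [ h φ , h ψ ]′ respects
        ; h-edge = copair-edge }
        where
        respects : ∀ {u w} → ParR G H u w → [ h φ , h ψ ]′ u ≡ [ h φ , h ψ ]′ w
        respects (inl u≈w) = h-cong φ u≈w
        respects (inr u≈w) = h-cong ψ u≈w
        respects glue-s    = src≡src
        respects glue-t    = tgt≡tgt

  Lang⇒⟦⟧ : {t : Term Alph} {G : Graph Alph} → Lang t G →
            (S : Structure Alph) (φ : Hom G S) → ⟦ t ⟧ S (h φ (src G)) (h φ (tgt G))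
  Lang⇒⟦⟧ (l-atom a)    S φ = h-edge φ a (refl , refl , refl)
  Lang⇒⟦⟧ l-one         S φ = refl
  Lang⇒⟦⟧ l-top         S φ = tt
  Lang⇒⟦⟧ (l-conv G∈t)  S φ = Lang⇒⟦⟧ G∈t S (swap-Hom φ)
  Lang⇒⟦⟧ (l-cap {s = s} G∈t H∈s) S φ =
    Lang⇒⟦⟧ G∈t S (∥-Homˡ φ) ,
    subst₂ (⟦ s ⟧ S) (sym (h-cong φ (return glue-s))) (sym (h-cong φ (return glue-t)))
      (Lang⇒⟦⟧ H∈s S (∥-Homʳ φ))
  Lang⇒⟦⟧ (l-seq {s = s} {H = H} G∈t H∈s) S φ =
    _ , Lang⇒⟦⟧ G∈t S (⊙-Homˡ φ) ,
    subst (λ z → ⟦ s ⟧ S z (h φ (inj₂ (tgt H)))) (sym (h-cong φ (return glue)))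
      (Lang⇒⟦⟧ H∈s S (⊙-Homʳ φ))
  Lang⇒⟦⟧ (l-plusˡ G∈t)  S φ = inj₁ (Lang⇒⟦⟧ G∈t S φ)
  Lang⇒⟦⟧ (l-plusʳ G∈s)  S φ = inj₂ (Lang⇒⟦⟧ G∈s S φ)
  Lang⇒⟦⟧ (l-star n G∈t) S φ = ⟦pow⟧⇒⟦⋆⟧ S n (Lang⇒⟦⟧ G∈t S φ)

  record Witness (t : Term Alph) (S : Structure Alph) (x y : Carrier S) : Set₁ where
    constructor witness
    field
      graph   : Graph Alph
      ∈𝒢      : Lang t graph
      hom     : Hom graph S
      hom-src : h hom (src graph) ≡ x
      hom-tgt : h hom (tgt graph) ≡ y

  module _ {S : Structure Alph} where

    Witness-map : {t t′ : Term Alph} → (∀ {G} → Lang t G → Lang t′ G) →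
                  {x y : Carrier S} → Witness t S x y → Witness t′ S x y
    Witness-map f (witness G G∈t φ φ-src φ-tgt) = witness G (f G∈t) φ φ-src φ-tgt

    Witness-⨾ : {t s : Term Alph} {x z y : Carrier S} →
                Witness t S x z → Witness s S z y → Witness (t ⨾ s) S x y
    Witness-⨾ (witness G G∈t φ φ-src φ-tgt) (witness H H∈s ψ ψ-src ψ-tgt) =
      witness (G ⊙ H) (l-seq G∈t H∈s) (⊙-Hom φ ψ (trans φ-tgt (sym ψ-src))) φ-src ψ-tgt

    Witness-∥ : {t s : Term Alph} {x y : Carrier S} →
                Witness t S x y → Witness s S x y → Witness (t ⊓ s) S x y
    Witness-∥ (witness G G∈t φ φ-src φ-tgt) (witness H H∈s ψ ψ-src ψ-tgt) =
      witness (G ∥ H) (l-cap G∈t H∈s)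
        (∥-Hom φ ψ (trans φ-src (sym ψ-src)) (trans φ-tgt (sym ψ-tgt))) φ-src φ-tgt

    Witness-˘ : {t : Term Alph} {x y : Carrier S} → Witness t S y x → Witness (t ˘) S x y
    Witness-˘ (witness G G∈t φ φ-src φ-tgt) =
      witness (swapGraph G) (l-conv G∈t) (swap-Hom φ) φ-tgt φ-src

    endpoints : Carrier S → Carrier S → Bool → Carrier S
    endpoints x y false = x
    endpoints x y true  = y

    ⟦⟧⇒Witness : (t : Term Alph) {x y : Carrier S} → ⟦ t ⟧ S x y → Witness t S x y
    ⟦⋆⟧⇒Witness : (t : Term Alph) {x y : Carrier S} →
                  ⟦ t ⋆ ⟧ S x y → ∃[ n ] Witness (pow n t) S x y

    ⟦⟧⇒Witness (atom a) {x} {y} p = witness (edgeGraph a) (l-atom a)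
      (record { h = endpoints x y ; h-cong = cong (endpoints x y)
              ; h-edge = λ { _ (refl , refl , refl) → p } })
      refl refl
    ⟦⟧⇒Witness one {x} refl = witness oneGraph l-one
      (record { h = λ _ → x ; h-cong = λ _ → refl ; h-edge = λ _ () }) refl refl
    ⟦⟧⇒Witness zer ()
    ⟦⟧⇒Witness top {x} {y} _ = witness topGraph l-top
      (record { h = endpoints x y ; h-cong = cong (endpoints x y) ; h-edge = λ _ () }) refl refl
    ⟦⟧⇒Witness (t ⨾ s) (_ , p , q) = Witness-⨾ (⟦⟧⇒Witness t p) (⟦⟧⇒Witness s q)
    ⟦⟧⇒Witness (t ⊕ s) (inj₁ p)    = Witness-map l-plusˡ (⟦⟧⇒Witness t p)
    ⟦⟧⇒Witness (t ⊕ s) (inj₂ q)    = Witness-map l-plusʳ (⟦⟧⇒Witness s q)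
    ⟦⟧⇒Witness (t ⊓ s) (p , q)     = Witness-∥ (⟦⟧⇒Witness t p) (⟦⟧⇒Witness s q)
    ⟦⟧⇒Witness (t ˘) p             = Witness-˘ (⟦⟧⇒Witness t p)
    ⟦⟧⇒Witness (t ⋆) p             = let n , w = ⟦⋆⟧⇒Witness t p in Witness-map (l-star n) w

    ⟦⋆⟧⇒Witness t ε        = 0 , ⟦⟧⇒Witness one refl
    ⟦⋆⟧⇒Witness t (p ◅ ps) =
      let n , w = ⟦⋆⟧⇒Witness t ps in suc n , Witness-⨾ (⟦⟧⇒Witness t p) w

-- Agda has no quotient types, so a quotient of A by R is presented by a type of
-- classes together with representatives. Decidable equality of classes is what
-- allows two classes to be glued (glue-Quotient).
record Quotient {A : Set} (R : Rel A 0ℓ) : Set₁ where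
  field
    Classes : Set
    _≟_     : DecidableEquality Classes
    [_]     : A → Classes
    rep     : Classes → A
    []-cong : ∀ {u w} → R u w → [ u ] ≡ [ w ]
    [rep]   : ∀ c → [ rep c ] ≡ c
    rep[]   : ∀ v → R (rep [ v ]) v

module _ {A : Set} where

  ≡-Quotient : DecidableEquality A → Quotient {A} _≡_
  ≡-Quotient _≟_ = record
    { Classes = A ; _≟_ = _≟_ ; [_] = λ v → v ; rep = λ c → c
    ; []-cong = λ u≡w → u≡w ; [rep] = λ _ → refl ; rep[] = λ _ → refl }

  Quotient-resp : {R R′ : Rel A 0ℓ} → R′ ⇒ R → R ⇒ R′ → Quotient R → Quotient R′
  Quotient-resp R′⇒R R⇒R′ Q = record
    { Classes = Classes ; _≟_ = _≟_ ; [_] = [_] ; rep = rep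
    ; []-cong = λ u~w → []-cong (R′⇒R u~w) ; [rep] = [rep] ; rep[] = λ v → R⇒R′ (rep[] v) }
    where open Quotient Q

  data Glued (R : Rel A 0ℓ) (a b : A) : Rel A 0ℓ where
    base  : ∀ {u w} → R u w → Glued R a b u w
    glued : Glued R a b a b

  module _ {R : Rel A 0ℓ} (Q : Quotient R) (a b : A) where
    open Quotient Q

    redirect : Classes → Classes
    redirect c with c ≟ [ b ]
    ... | yes _ = [ a ]
    ... | no  _ = c

    redirect-[b] : redirect [ b ] ≡ [ a ]
    redirect-[b] with [ b ] ≟ [ b ]
    ... | yes _    = refl
    ... | no  b≢b  = ⊥-elim (b≢b refl)

    redirect-≢ : ∀ {c} → ¬ c ≡ [ b ] → redirect c ≡ c
    redirect-≢ {c} c≢b with c ≟ [ b ]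
    ... | yes c≡b = ⊥-elim (c≢b c≡b)
    ... | no  _   = refl

    redirect-[a] : redirect [ a ] ≡ [ a ]
    redirect-[a] with [ a ] ≟ [ b ]
    ... | yes _ = refl
    ... | no  _ = refl

    redirect-idem : ∀ c → redirect (redirect c) ≡ redirect c
    redirect-idem c with c ≟ [ b ]
    ... | yes _   = redirect-[a]
    ... | no  c≢b = redirect-≢ c≢b

    -- The classes after gluing are the fixed points of redirect; UIP for the
    -- decidable type Classes makes the fixed-point proofs irrelevant.
    Fixed : Set
    Fixed = Σ Classes (λ c → redirect c ≡ c)

    open Decidable⇒UIP _≟_ using (≡-irrelevant)

    Fixed-≡ : ∀ {c d} {p : redirect c ≡ c} {q : redirect d ≡ d} →
              c ≡ d → _≡_ {A = Fixed} (c , p) (d , q)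
    Fixed-≡ refl = cong (_ ,_) (≡-irrelevant _ _)

    _≟Fixed_ : DecidableEquality Fixed
    (c , _) ≟Fixed (d , _) with c ≟ d
    ... | yes c≡d = yes (Fixed-≡ c≡d)
    ... | no  c≢d = no (λ e → c≢d (cong proj₁ e))

    private
      [_]′ : A → Classes
      [ v ]′ = redirect [ v ]

      []′-respects : ∀ {u w} → Glued R a b u w → [ u ]′ ≡ [ w ]′
      []′-respects (base u~w) = cong redirect ([]-cong u~w)
      []′-respects glued      = trans redirect-[a] (sym redirect-[b])

      rep[]′ : ∀ v → EqClosure (Glued R a b) (rep [ v ]′) v
      rep[]′ v with [ v ] ≟ [ b ]
      ... | no  _       = return (base (rep[] v))
      ... | yes [v]≡[b] = begin
        rep [ a ] ≈⟨ return (base (rep[] a)) ⟩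
        a         ≈⟨ return glued ⟩
        b         ≈⟨ return (base (rep[] b)) ⟨
        rep [ b ] ≡⟨ cong rep [v]≡[b] ⟨
        rep [ v ] ≈⟨ return (base (rep[] v)) ⟩
        v         ∎
        where open ≈-Reasoning (EqClosure-setoid (Glued R a b))

    glue-Quotient : Quotient (EqClosure (Glued R a b))
    glue-Quotient = record
      { Classes = Fixed ; _≟_ = _≟Fixed_
      ; [_] = λ v → [ v ]′ , redirect-idem [ v ]
      ; rep = λ c → rep (proj₁ c)
      ; []-cong = λ u≈w → Fixed-≡ (gfold isEquivalence [_]′ []′-respects u≈w)
      ; [rep] = λ { (c , p) → Fixed-≡ (trans (cong redirect ([rep] c)) p) }
      ; rep[] = rep[]′ }

module _ {A B : Set} {R : Rel A 0ℓ} {R′ : Rel B 0ℓ} where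

  ⊎-Quotient : Quotient R → Quotient R′ → Quotient (Pointwise R R′)
  ⊎-Quotient Q Q′ = record
    { Classes = Classes Q ⊎ Classes Q′ ; _≟_ = ≡-dec (_≟_ Q) (_≟_ Q′)
    ; [_] = [ (λ u → inj₁ ([_] Q u)) , (λ u → inj₂ ([_] Q′ u)) ]′
    ; rep = [ (λ c → inj₁ (rep Q c)) , (λ c → inj₂ (rep Q′ c)) ]′
    ; []-cong = λ { (inj₁ u~w) → cong inj₁ ([]-cong Q u~w)
                  ; (inj₂ u~w) → cong inj₂ ([]-cong Q′ u~w) }
    ; [rep] = λ { (inj₁ c) → cong inj₁ ([rep] Q c) ; (inj₂ c) → cong inj₂ ([rep] Q′ c) }
    ; rep[] = λ { (inj₁ v) → inj₁ (rep[] Q v) ; (inj₂ v) → inj₂ (rep[] Q′ v) } }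
    where open Quotient

module _ {Alph : Set} where
  open Hom

  module _ {G H : Graph Alph} (QG : Quotient (_≈_ G)) (QH : Quotient (_≈_ H)) where

    ⊙-Quotient : Quotient (_≈_ (G ⊙ H))
    ⊙-Quotient =
      Quotient-resp (fold (EqClosure-isEquivalence _) SerR⇒Glued)
                    (fold (EqClosure-isEquivalence _) Glued⇒SerR)
        (glue-Quotient (⊎-Quotient QG QH) (inj₁ (tgt G)) (inj₂ (src H)))
      where
      Glued-⊙ : Rel (V G ⊎ V H) 0ℓ
      Glued-⊙ = Glued (Pointwise (_≈_ G) (_≈_ H)) (inj₁ (tgt G)) (inj₂ (src H))

      SerR⇒Glued : SerR G H ⇒ EqClosure Glued-⊙
      SerR⇒Glued (inl u≈w) = return (base (inj₁ u≈w))
      SerR⇒Glued (inr u≈w) = return (base (inj₂ u≈w))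
      SerR⇒Glued glue      = return glued

      Glued⇒SerR : Glued-⊙ ⇒ EqClosure (SerR G H)
      Glued⇒SerR (base (inj₁ u≈w)) = return (inl u≈w)
      Glued⇒SerR (base (inj₂ u≈w)) = return (inr u≈w)
      Glued⇒SerR glued             = return glue

    ∥-Quotient : Quotient (_≈_ (G ∥ H))
    ∥-Quotient =
      Quotient-resp (fold (EqClosure-isEquivalence _) ParR⇒Glued)
                    (fold (EqClosure-isEquivalence _) Glued⇒ParR)
        (glue-Quotient (glue-Quotient (⊎-Quotient QG QH) (inj₁ (src G)) (inj₂ (src H)))
                       (inj₁ (tgt G)) (inj₂ (tgt H)))
      where
      Glued-src : Rel (V G ⊎ V H) 0ℓ
      Glued-src = Glued (Pointwise (_≈_ G) (_≈_ H)) (inj₁ (src G)) (inj₂ (src H))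

      Glued-∥ : Rel (V G ⊎ V H) 0ℓ
      Glued-∥ = Glued (EqClosure Glued-src) (inj₁ (tgt G)) (inj₂ (tgt H))

      ParR⇒Glued : ParR G H ⇒ EqClosure Glued-∥
      ParR⇒Glued (inl u≈w) = return (base (return (base (inj₁ u≈w))))
      ParR⇒Glued (inr u≈w) = return (base (return (base (inj₂ u≈w))))
      ParR⇒Glued glue-s    = return (base (return glued))
      ParR⇒Glued glue-t    = return glued

      Glued-src⇒ParR : Glued-src ⇒ EqClosure (ParR G H)
      Glued-src⇒ParR (base (inj₁ u≈w)) = return (inl u≈w)
      Glued-src⇒ParR (base (inj₂ u≈w)) = return (inr u≈w)
      Glued-src⇒ParR glued             = return glue-s

      Glued⇒ParR : Glued-∥ ⇒ EqClosure (ParR G H)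
      Glued⇒ParR (base u∼w) = fold (EqClosure-isEquivalence _) Glued-src⇒ParR u∼w
      Glued⇒ParR glued      = return glue-t

  Lang⇒Quotient : {t : Term Alph} {G : Graph Alph} → Lang t G → Quotient (_≈_ G)
  Lang⇒Quotient (l-atom a)        = ≡-Quotient _≟𝔹_
  Lang⇒Quotient l-one             = ≡-Quotient _≟⊤_
  Lang⇒Quotient l-top             = ≡-Quotient _≟𝔹_
  Lang⇒Quotient (l-conv G∈t)      = Lang⇒Quotient G∈t
  Lang⇒Quotient (l-cap G∈t H∈s)   = ∥-Quotient (Lang⇒Quotient G∈t) (Lang⇒Quotient H∈s)
  Lang⇒Quotient (l-seq G∈t H∈s)   = ⊙-Quotient (Lang⇒Quotient G∈t) (Lang⇒Quotient H∈s)
  Lang⇒Quotient (l-plusˡ G∈t)     = Lang⇒Quotient G∈t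
  Lang⇒Quotient (l-plusʳ G∈s)     = Lang⇒Quotient G∈s
  Lang⇒Quotient (l-star n G∈t)    = Lang⇒Quotient G∈t

  module _ (G : Graph Alph) (Q : Quotient (_≈_ G)) where
    open Quotient Q

    quotientStructure : Structure Alph
    quotientStructure = record
      { Carrier = Classes ; nonempty = [ src G ]
      ; rel = λ a i j → EdgeCl G a (rep i) (rep j) }

    []-Hom : Hom G quotientStructure
    []-Hom = record
      { h = [_] ; h-cong = []-cong
      ; h-edge = λ a {u} {w} e → u , w , rep[] u , rep[] w , e }

    quotient-Iso : Iso (graphOf quotientStructure [ src G ] [ tgt G ]) G
    quotient-Iso = record
      { to = rep ; from = [_]
      ; to-cong = λ { refl → IsEquivalence.refl (isEq G) }
      ; from-cong = []-cong
      ; from-to = [rep]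
      ; to-from = rep[]
      ; preserve = λ { a i j (_ , _ , refl , refl , e) → e }
      ; reflect = λ a i j e → i , j , refl , refl , e
      ; pres-src = rep[] (src G)
      ; pres-tgt = rep[] (tgt G) }

    quotient-rel : {S : Structure Alph} (φ : Hom G S) →
                   ∀ a {i j} → rel quotientStructure a i j → rel S a (h φ (rep i)) (h φ (rep j))
    quotient-rel {S} φ a (_ , _ , i≈u , j≈w , e) =
      subst₂ (rel S a) (sym (h-cong φ i≈u)) (sym (h-cong φ j≈w)) (h-edge φ a e)

  ⊨-𝒞⇒⊨-REL : (t s : Term Alph) → 𝒞 t ⊨ t ≤ s → REL ⊨ t ≤ s
  ⊨-𝒞⇒⊨-REL t s t≤s S _ x y t[x,y] with ⟦⟧⇒Witness t t[x,y]
  ... | witness G G∈t φ φ-src φ-tgt =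
    subst₂ (⟦ s ⟧ S) (trans (h-cong φ (rep[] (src G))) φ-src)
                     (trans (h-cong φ (rep[] (tgt G))) φ-tgt)
      (⟦⟧-preserved s (λ c → h φ (rep c)) (quotient-rel G Q φ) s-in-S/G)
    where
    Q : Quotient (_≈_ G)
    Q = Lang⇒Quotient G∈t
    open Quotient Q

    S/G : Structure Alph
    S/G = quotientStructure G Q

    s-in-S/G : ⟦ s ⟧ S/G [ src G ] [ tgt G ]
    s-in-S/G = t≤s S/G ([ src G ] , [ tgt G ] , G , G∈t , quotient-Iso G Q) _ _
                 (Lang⇒⟦⟧ G∈t S/G ([]-Hom G Q))

proposition2p8 : {Alph : Set} (t s : Term Alph) → (REL ⊨ t ≤ s) ⇔ (𝒞 t ⊨ t ≤ s)
proposition2p8 t s = mk⇔ (λ t≤s S _ → t≤s S (lift tt)) (⊨-𝒞⇒⊨-REL t s)
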